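{- Let $i,j_1,\dots,j_m$ be positive integers with $\sum_{l=1}^m j_l\le i$. Then $\Pi(j_1)\cdots\Pi(j_m)$ divides $\Pi(i)$, where $\Pi(t)=\prod_{s=1}^{t}s!$. -}

module Defs where

open import Data.Nat using (ℕ; zero; suc; _*_; _!)

Π : ℕ → ℕ
Π zero = 1
Π (suc t) = Π t * (suc t) !

{-# OPTIONS --safe #-}
module Submission where

-- Π (m + n) = Π m · ∏_{s=1}^{n} (m + s)!, and each factor (m + s)! is a multiple of
-- the matching factor s! of Π n; so Π m · Π n ∣ Π (m + n).  Iterating over the list
-- gives ∏ Π j ∣ Π (∑ j), and Π is monotone for divisibility.

open import Defs
open import Data.Product using (_,_)
open import Data.Nat using (ℕ; _≤_; _<_; s≤s; zero; suc; _+_; _*_; _!)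
open import Data.Nat.Properties using (*-assoc; *-identityʳ; +-identityʳ; +-suc; m≤n+m; m≤n⇒∃[o]m+o≡n)
open import Data.Nat.Divisibility
open import Data.List using (List; map; []; _∷_)
open import Data.Nat.ListAction using (sum; product)
open import Data.List.Relation.Unary.All using (All)
open import Relation.Binary.PropositionalEquality using (refl; cong)

Π-*-∣-Π-+ : ∀ m n → Π m * Π n ∣ Π (m + n)
Π-*-∣-Π-+ m zero = begin
  Π m * 1      ≡⟨ *-identityʳ (Π m) ⟩
  Π m          ≡⟨ cong Π (+-identityʳ m) ⟨
  Π (m + zero) ∎
  where open ∣-Reasoning
Π-*-∣-Π-+ m (suc n) = begin
  Π m * (Π n * suc n !)       ≡⟨ *-assoc (Π m) (Π n) (suc n !) ⟨
  Π m * Π n * suc n !         ∣⟨ *-pres-∣ (Π-*-∣-Π-+ m n) (m≤n⇒m!∣n! (s≤s (m≤n+m n m))) ⟩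
  Π (m + n) * suc (m + n) !   ≡⟨ cong Π (+-suc m n) ⟨
  Π (m + suc n)               ∎
  where open ∣-Reasoning

Π-mono-∣ : ∀ {m n} → m ≤ n → Π m ∣ Π n
Π-mono-∣ {m} m≤n with m≤n⇒∃[o]m+o≡n m≤n
... | o , refl = ∣-trans (m∣m*n (Π o)) (Π-*-∣-Π-+ m o)

product-Π-∣-Π-sum : ∀ js → product (map Π js) ∣ Π (sum js)
product-Π-∣-Π-sum []       = ∣-refl
product-Π-∣-Π-sum (j ∷ js) =
  ∣-trans (*-monoʳ-∣ (Π j) (product-Π-∣-Π-sum js)) (Π-*-∣-Π-+ j (sum js))

mainTheorem15 : (i : ℕ) → (js : List ℕ) → 0 < i → All (λ j → 0 < j) js →
    sum js ≤ i → product (map Π js) ∣ Π i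
mainTheorem15 i js _ _ ∑js≤i = ∣-trans (product-Π-∣-Π-sum js) (Π-mono-∣ ∑js≤i)
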